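{- Let $G$ be a finite abelian group (written multiplicatively) and $\vec\gamma=(\gamma_1,\dots,\gamma_n)$ a sequence of generators of $G$. Algorithm 2.2 (described in the context) is correct, i.e. it outputs $r_i=|G_i:G_{i-1}|$ and $s_i=Z(\vec x)$ where $\vec x$ is the unique vector in $X(\vec\gamma)$ with $\gamma_i^{r_i}=\vec\gamma^{\vec x}$, for $i=1,\dots,n$. It uses $|G|$ non-trivial group operations, makes $|G|$ calls to TableInsert, and makes $\sum_i r_i$ calls to TableLookup.
   Context: Put $G_i=\langle\gamma_1,\dots,\gamma_i\rangle$, $G_0=1$, and $r_i=|G_i:G_{i-1}|$. Let $X(\vec\gamma)=\{\vec x\in\mathbb{Z}^n:0\le x_i<r_i\}$ and $\vec\gamma^{\vec x}=\gamma_1^{x_1}\cdots\gamma_n^{x_n}$; every element of $G$ equals $\vec\gamma^{\vec x}$ for a unique $\vec x\in X(\vec\gamma)$. Define $Z(\vec x)=\sum_{j=1}^n N_jx_j$ with $N_j=\prod_{1\le i<j}r_i$. A table $T$ stores group elements in an array, TableInsert$(T,\beta)$ placing $\beta$ in the next free entry, TableSize$(T)$ giving the number of entries, and TableLookup$(T,\beta)$ returning the index $j$ with $T[j]=\beta$ or failing if none. Algorithm 2.2: (1) Let $T$ be empty and call TableInsert$(T,1_G)$. (2) For $i=1,\dots,n$: (3) set $\beta\leftarrow\gamma_i$, $r_i\leftarrow1$, $N\leftarrow$TableSize$(T)$; (4) until $s_i\leftarrow$TableLookup$(T,\beta)$ succeeds: (5) for $j=0,\dots,N-1$ call TableInsert$(T,\beta\cdot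 T[j])$; (6) set $\beta\leftarrow\beta\gamma_i$ and $r_i\leftarrow r_i+1$. (7) Output $(r_1,\dots,r_n)$ and $(s_1,\dots,s_n)$. -}

module Defs where

open import Level using (Level; _⊔_)
open import Algebra.Bundles using (AbelianGroup)
open import Data.Nat using (ℕ; zero; suc; _+_; _*_; _≤_; _<_)
open import Data.Fin using (Fin; toℕ)
open import Data.Vec using (Vec; []; _∷_; lookup; toList)
import Data.List as List
open import Data.List using (List; []; _∷_; _++_; [_])
open import Data.Nat.ListAction using (sum; product)
open import Data.Maybe using (Maybe; just; nothing)
open import Data.Product using (Σ; ∃; _×_; _,_)
open import Data.Bool using (Bool; true; false; _∨_; if_then_else_)
open import Relation.Binary using (Decidable)
open import Relation.Nullary using (yes; no)
open import Relation.Nullary.Decidable using (⌊_⌋)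

module Grp {c ℓ : Level} (G : AbelianGroup c ℓ) where
  open AbelianGroup G renaming (Carrier to A)

  pow : A → ℕ → A
  pow g zero    = ε
  pow g (suc k) = g ∙ pow g k

  vecPow : ∀ {n} → Vec A n → Vec ℕ n → A
  vecPow []       []       = ε
  vecPow (g ∷ gs) (x ∷ xs) = pow g x ∙ vecPow gs xs

  HasSize : (A → Set ℓ) → ℕ → Set (c ⊔ ℓ)
  HasSize P k = Σ (Fin k → A) λ e →
      (∀ a → P (e a))
    × (∀ a b → e a ≈ e b → a ≡′ b)
    × (∀ g → P g → ∃ λ a → e a ≈ g)
    where open import Relation.Binary.PropositionalEquality renaming (_≡_ to _≡′_)

  Order : ℕ → Set (c ⊔ ℓ)
  Order m = HasSize (λ _ → Lift′) m
    where open import Data.Unit.Polymorphic using () renaming (⊤ to Lift′)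

  -- G_i = ⟨γ_1,…,γ_i⟩ (G abelian, so its elements are the products
  -- γ_1^{x_1}⋯γ_i^{x_i}; here: γ^x with x_j = 0 for all j > i).
  InSub : ∀ {n} → Vec A n → ℕ → A → Set ℓ
  InSub {n} γ i g = ∃ λ (x : Vec ℕ n) →
      (∀ (j : Fin n) → i ≤ toℕ j → lookup x j ≡′ 0)
    × (g ≈ vecPow γ x)
    where open import Relation.Binary.PropositionalEquality renaming (_≡_ to _≡′_)

  Generates : ∀ {n} → Vec A n → Set (c ⊔ ℓ)
  Generates {n} γ = ∀ g → InSub γ n g

  -- |G_i : G_{i-1}| = r  (for i = toℕ j + 1):  |G_i| = r · |G_{i-1}|
  IsIndex : ∀ {n} → Vec A n → Fin n → ℕ → Set (c ⊔ ℓ)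
  IsIndex γ j r = ∃ λ a → ∃ λ b →
      HasSize (InSub γ (toℕ j)) a
    × HasSize (InSub γ (suc (toℕ j))) b
    × b ≡′ r * a
    where open import Relation.Binary.PropositionalEquality renaming (_≡_ to _≡′_)

  -- N_j = ∏_{i<j} r_i  (0-based j),  Z(x) = Σ_j N_j x_j
  Nfac : ∀ {n} → Vec ℕ n → Fin n → ℕ
  Nfac r j = product (List.take (toℕ j) (toList r))

  Z : ∀ {n} → Vec ℕ n → Vec ℕ n → ℕ
  Z {n} r x = sum (List.map (λ j → Nfac r j * lookup x j) (List.allFin n))

  -- Algorithm 2.2, instrumented with counters.
  -- Requires decidable equality in G (for TableLookup).
  module Algorithm (_≟_ : Decidable _≈_) where

    record State : Set c where
      field
        table   : List A   -- T, entries T[0], T[1], … (0-based)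
        ops     : ℕ        -- number of non-trivial group multiplications
        inserts : ℕ
        lookups : ℕ
    open State public

    cost : A → A → ℕ
    cost x y = if ⌊ x ≟ ε ⌋ ∨ ⌊ y ≟ ε ⌋ then 0 else 1

    tableLookup : List A → A → Maybe ℕ
    tableLookup []      β = nothing
    tableLookup (t ∷ T) β with t ≟ β
    ... | yes _ = just 0
    ... | no  _ = Data.Maybe.map suc (tableLookup T β)
      where import Data.Maybe

    insertProd : A → A → State → State
    insertProd β x st = record st
      { table   = table st ++ [ β ∙ x ]
      ; ops     = ops st + cost β x
      ; inserts = suc (inserts st) }

    -- step (5): for j = 0,…,N-1 : TableInsert(T, β·T[j]);
    -- `old` is the list T[0..N-1] (entries are never changed, only appended)
    insertAll : A → List A → State → State
    insertAll β []      st = st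
    insertAll β (x ∷ xs) st = insertAll β xs (insertProd β x st)

    -- steps (4)–(6); the first argument is fuel (only to make the
    -- `until` loop structurally recursive; `nothing` = ran out of fuel)
    loop : ℕ → (γi β : A) (r : ℕ) (old : List A) → State → Maybe (ℕ × ℕ × State)
    loop zero    γi β r old st = nothing
    loop (suc f) γi β r old st = step (tableLookup (table st) β)
      where
        st₁ : State
        st₁ = record st { lookups = suc (lookups st) }
        step : Maybe ℕ → Maybe (ℕ × ℕ × State)
        step (just s) = just (r , s , st₁)
        step nothing  = loop f γi (β ∙ γi) (suc r)  old
                          (record st₂ { ops = ops st₂ + cost β γi })
          where st₂ = insertAll β old st₁

    -- step (2): for i = 1,…,n ; step (3): β ← γ_i, r_i ← 1, N ← TableSize(T)
    outer : ℕ → ∀ {k} → Vec A k → State → Maybe (Vec ℕ k × Vec ℕ k × State)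
    outer f []       st = just ([] , [] , st)
    outer f (g ∷ gs) st = k (loop f g g 1 (table st) st)
      where
        k : Maybe (ℕ × ℕ × State) → Maybe (Vec ℕ _ × Vec ℕ _ × State)
        k nothing = nothing
        k (just (r , s , st′)) = k′ (outer f gs st′)
          where
            k′ : Maybe (Vec ℕ _ × Vec ℕ _ × State) → Maybe (Vec ℕ _ × Vec ℕ _ × State)
            k′ nothing = nothing
            k′ (just (rs , ss , st″)) = just (r ∷ rs , s ∷ ss , st″)

    -- step (1): T ← [1_G] (one call to TableInsert); returns (r, s, final counters)
    initial : State
    initial = record { table = [ ε ] ; ops = 0 ; inserts = 1 ; lookups = 0 }

    run : ℕ → ∀ {n} → Vec A n → Maybe (Vec ℕ n × Vec ℕ n × State)
    run f γ = outer f γ initial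

{-# OPTIONS --safe #-}
module Submission where

-- After the first i generators have been processed, the table T lists every element of
-- Gᵢ exactly once, γ^x being stored at position Z(x) for the x in the box of the radices
-- found so far. Processing γᵢ appends the cosets γᵢ^q · T, q = 1, 2, …, looking up γᵢ^r
-- before appending γᵢ^r · T. A hit in a coset with q > 0 would put γᵢ^(r-q) in Gᵢ,
-- contradicting the minimality of r, so the lookup fails exactly as long as γᵢ^r ∉ Gᵢ:
-- the loop stops at r = |Gᵢ₊₁ : Gᵢ|, at the position of γᵢ^r in the old table, and the
-- new table lists Gᵢ₊₁ in the same layout. Distinctness of the entries bounds every loop
-- by |G|, and the counts follow because T[0] = 1 is the only entry that makes a product
-- trivial.

open import Defs
open import Level using (Level; _⊔_)
open import Algebra.Bundles using (AbelianGroup)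
open import Data.Empty using (⊥; ⊥-elim)
open import Data.Fin using (Fin; zero; suc; toℕ; fromℕ<)
import Data.Fin.Properties as Finₚ
open import Data.List using (List; []; _∷_; _++_; [_]; length; map)
import Data.List as List
import Data.List.Properties as List
open import Data.Maybe using (just; nothing)
open import Data.Nat
  using (ℕ; zero; suc; _+_; _*_; _∸_; _≤_; _<_; z≤n; s≤s; s≤s⁻¹; NonZero; >-nonZero)
import Data.Nat.Properties as ℕ
open import Data.Nat.DivMod using (_/_; _%_; m≡m%n+[m/n]*n; m%n<n; m<n*o⇒m/o<n)
open import Data.Nat.ListAction using (sum; product)
open import Data.Nat.ListAction.Properties using (sum-++; product-++)
open import Data.Nat.Tactic.RingSolver using (solve-∀)
import Data.Product
open import Data.Product using (Σ; ∃; ∃₂; _×_; _,_; proj₁; proj₂)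
open import Data.Sum using (inj₁; inj₂)
open import Data.Vec using (Vec; []; _∷_; lookup; toList; zipWith; replicate)
import Data.Vec.Properties
open import Function using (_∘_; id)
open import Relation.Binary using (Decidable; Tri; tri<; tri≈; tri>)
open import Relation.Binary.PropositionalEquality as ≡
  using (_≡_; _≢_; refl; module ≡-Reasoning)
open import Relation.Nullary using (¬_; yes; no)

module _ {a : Level} {X : Set a} (d : X) where

  at : List X → ℕ → X
  at []       _       = d
  at (x ∷ xs) zero    = x
  at (x ∷ xs) (suc k) = at xs k

  at-++ˡ : ∀ xs ys {k} → k < length xs → at (xs ++ ys) k ≡ at xs k
  at-++ˡ (x ∷ xs) ys {zero}  _        = refl
  at-++ˡ (x ∷ xs) ys {suc k} (s≤s k<) = at-++ˡ xs ys k<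

  at-++ʳ : ∀ xs ys k → at (xs ++ ys) (length xs + k) ≡ at ys k
  at-++ʳ []       ys k = refl
  at-++ʳ (x ∷ xs) ys k = at-++ʳ xs ys k

  at-∷ʳ : ∀ xs y → at (xs ++ [ y ]) (length xs) ≡ y
  at-∷ʳ xs y = ≡.trans (≡.cong (at (xs ++ [ y ])) (≡.sym (ℕ.+-identityʳ (length xs))))
                       (at-++ʳ xs [ y ] 0)

  at-∷ʳ⁺ : ∀ {p} (P : ℕ → X → Set p) xs y →
           (∀ l → l < length xs → P l (at xs l)) → P (length xs) y →
           ∀ l → l < length (xs ++ [ y ]) → P l (at (xs ++ [ y ]) l)
  at-∷ʳ⁺ P xs y Pxs Py l l<
    with ℕ.m≤n⇒m<n∨m≡n (s≤s⁻¹ (≡.subst (l <_) (≡.trans (List.length-++ xs) (ℕ.+-comm _ 1)) l<))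
  ... | inj₁ l<xs = ≡.subst (P l) (≡.sym (at-++ˡ xs [ y ] l<xs)) (Pxs l l<xs)
  ... | inj₂ refl = ≡.subst (P _) (≡.sym (at-∷ʳ xs y)) Py

  at-toList-≥ : ∀ {n} (v : Vec X n) {l} → n ≤ l → at (toList v) l ≡ d
  at-toList-≥ []                _         = refl
  at-toList-≥ (x ∷ v) {suc l} (s≤s n≤l) = at-toList-≥ v n≤l

  at-replicate : ∀ n l → at (toList (replicate n d)) l ≡ d
  at-replicate zero    l       = refl
  at-replicate (suc n) zero    = refl
  at-replicate (suc n) (suc l) = at-replicate n l

  lookup≡at-toList : ∀ {n} (v : Vec X n) (j : Fin n) → lookup v j ≡ at (toList v) (toℕ j)
  lookup≡at-toList (x ∷ v) zero    = refl
  lookup≡at-toList (x ∷ v) (suc j) = lookup≡at-toList v j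

at-map : ∀ {a b} {X : Set a} {Y : Set b} {d : X} {e : Y} (f : X → Y) xs {k} →
         k < length xs → at e (map f xs) k ≡ f (at d xs k)
at-map f (x ∷ xs) {zero}  _        = refl
at-map f (x ∷ xs) {suc k} (s≤s k<) = at-map f xs k<

at-zipWith : ∀ {a b c} {X : Set a} {Y : Set b} {Z : Set c} {d : X} {e : Y} (f : X → Y → Z)
             {n} (u : Vec X n) (v : Vec Y n) l →
             at (f d e) (toList (zipWith f u v)) l ≡ f (at d (toList u) l) (at e (toList v) l)
at-zipWith f []      []      l       = refl
at-zipWith f (x ∷ u) (y ∷ v) zero    = refl
at-zipWith f (x ∷ u) (y ∷ v) (suc l) = at-zipWith f u v l

-- Unlike Data.Vec._[_]≔_ this is indexed by ℕ; out-of-range updates are no-ops.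
module _ {a : Level} {X : Set a} where

  _[_]≔_ : ∀ {n} → Vec X n → ℕ → X → Vec X n
  []      [ _     ]≔ _ = []
  (x ∷ v) [ zero  ]≔ y = y ∷ v
  (x ∷ v) [ suc i ]≔ y = x ∷ (v [ i ]≔ y)

  at-[]≔-≡ : ∀ d {n} (v : Vec X n) {i} y → i < n → at d (toList (v [ i ]≔ y)) i ≡ y
  at-[]≔-≡ d (x ∷ v) {zero}  y _        = refl
  at-[]≔-≡ d (x ∷ v) {suc i} y (s≤s i<) = at-[]≔-≡ d v y i<

  at-[]≔-≢ : ∀ d {n} (v : Vec X n) {i} y {l} → l ≢ i →
             at d (toList (v [ i ]≔ y)) l ≡ at d (toList v) l
  at-[]≔-≢ d []      y                 _   = refl
  at-[]≔-≢ d (x ∷ v) {zero}  y {zero}  l≢i = ⊥-elim (l≢i refl)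
  at-[]≔-≢ d (x ∷ v) {zero}  y {suc l} _   = refl
  at-[]≔-≢ d (x ∷ v) {suc i} y {zero}  _   = refl
  at-[]≔-≢ d (x ∷ v) {suc i} y {suc l} l≢i = at-[]≔-≢ d v y (l≢i ∘ ≡.cong suc)

_!_ : List ℕ → ℕ → ℕ
_!_ = at 0

-- horner rs x = Σₗ (∏_{l′<l} rs ! l′) · x l: the paper's Z(x) for the radices rs.
horner : List ℕ → (ℕ → ℕ) → ℕ
horner []       x = 0
horner (r ∷ rs) x = x 0 + r * horner rs (x ∘ suc)

horner-∷ʳ : ∀ rs r x → horner (rs ++ [ r ]) x ≡ horner rs x + product rs * x (length rs)
horner-∷ʳ []       r x = ≡.cong (x 0 +_) (ℕ.*-zeroʳ r)
horner-∷ʳ (a ∷ rs) r x = begin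
  x 0 + a * horner (rs ++ [ r ]) (x ∘ suc)
    ≡⟨ ≡.cong (λ h → x 0 + a * h) (horner-∷ʳ rs r (x ∘ suc)) ⟩
  x 0 + a * (horner rs (x ∘ suc) + product rs * x (suc (length rs)))
    ≡⟨ distrib (x 0) a _ (product rs) _ ⟩
  x 0 + a * horner rs (x ∘ suc) + a * product rs * x (suc (length rs))
    ∎
  where
    open ≡-Reasoning
    distrib : ∀ u a h p v → u + a * (h + p * v) ≡ u + a * h + a * p * v
    distrib = solve-∀

horner-cong : ∀ rs {x y} → (∀ l → l < length rs → x l ≡ y l) → horner rs x ≡ horner rs y
horner-cong []       _   = refl
horner-cong (r ∷ rs) x≗y = ≡.cong₂ (λ u h → u + r * h)
  (x≗y 0 (s≤s z≤n)) (horner-cong rs (λ l l< → x≗y (suc l) (s≤s l<)))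

horner-vanishing : ∀ rs {x} → (∀ l → x l ≡ 0) → horner rs x ≡ 0
horner-vanishing []       _   = refl
horner-vanishing (r ∷ rs) x≗0
  rewrite x≗0 0 | horner-vanishing rs (x≗0 ∘ suc) = ℕ.*-zeroʳ r

horner-++ : ∀ rs more {x} → (∀ l → length rs ≤ l → x l ≡ 0) → horner (rs ++ more) x ≡ horner rs x
horner-++ []       more x≗0 = horner-vanishing more (λ l → x≗0 l z≤n)
horner-++ (r ∷ rs) more x≗0 =
  ≡.cong (λ h → _ + r * h) (horner-++ rs more (λ l rs≤l → x≗0 (suc l) (s≤s rs≤l)))

sum-map-*ˡ : ∀ a xs → sum (map (a *_) xs) ≡ a * sum xs
sum-map-*ˡ a []       = ≡.sym (ℕ.*-zeroʳ a)
sum-map-*ˡ a (x ∷ xs) = ≡.trans (≡.cong (a * x +_) (sum-map-*ˡ a xs))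
                                (≡.sym (ℕ.*-distribˡ-+ a x (sum xs)))

mixed-radix-sum≡horner : ∀ {n} (r x : Vec ℕ n) →
  sum (map (λ j → product (List.take (toℕ j) (toList r)) * lookup x j) (List.allFin n))
    ≡ horner (toList r) (toList x !_)
mixed-radix-sum≡horner []      []      = refl
mixed-radix-sum≡horner (a ∷ r) (b ∷ x) = begin
  sum (map F (List.allFin _))
    ≡⟨ ≡.cong sum (List.map-tabulate id F) ⟩
  1 * b + sum (List.tabulate (λ j → a * N j * lookup x j))
    ≡⟨ ≡.cong₂ _+_ (ℕ.*-identityˡ b)
                   (≡.cong sum (List.tabulate-cong λ j → ℕ.*-assoc a (N j) (lookup x j))) ⟩
  b + sum (List.tabulate ((a *_) ∘ F′))
    ≡⟨ ≡.cong (λ l → b + sum l) (List.map-tabulate F′ (a *_)) ⟨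
  b + sum (map (a *_) (List.tabulate F′))
    ≡⟨ ≡.cong (b +_) (sum-map-*ˡ a (List.tabulate F′)) ⟩
  b + a * sum (List.tabulate F′)
    ≡⟨ ≡.cong (λ l → b + a * sum l) (List.map-tabulate id F′) ⟨
  b + a * sum (map F′ (List.allFin _))
    ≡⟨ ≡.cong (λ h → b + a * h) (mixed-radix-sum≡horner r x) ⟩
  b + a * horner (toList r) (toList x !_)
    ∎
  where
    open ≡-Reasoning
    N  = λ j → product (List.take (toℕ j) (toList r))
    F  = λ j → product (List.take (toℕ j) (toList (a ∷ r))) * lookup (b ∷ x) j
    F′ = λ j → N j * lookup x j

mixed-radix-< : ∀ {N r q j} → j < N → q < r → j + q * N < r * N
mixed-radix-< {N} {r} {q} {j} j<N q<r = begin-strict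
  j + q * N  <⟨ ℕ.+-monoˡ-< (q * N) j<N ⟩
  suc q * N  ≤⟨ ℕ.*-monoˡ-≤ N q<r ⟩
  r * N      ∎
  where open ℕ.≤-Reasoning

divMod-view : ∀ {r N k} .{{_ : NonZero N}} → k < r * N →
              ∃₂ λ q j → q < r × j < N × k ≡ j + q * N
divMod-view {N = N} {k} k< = k / N , k % N , m<n*o⇒m/o<n k< , m%n<n k N , m≡m%n+[m/n]*n k N

ops-step : ∀ {o S N r} → suc o ≡ r * N → suc S ≡ N → suc (o + S + 1) ≡ suc r * N
ops-step {o} {S} {N} {r} o≡ refl = begin
  suc (o + S + 1)    ≡⟨ shuffle o S ⟩
  suc S + suc o      ≡⟨ ≡.cong (suc S +_) o≡ ⟩
  suc S + r * suc S  ∎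
  where
    open ≡-Reasoning
    shuffle : ∀ o S → suc (o + S + 1) ≡ suc S + suc o
    shuffle = solve-∀

SupportedBelow : ∀ {n} → ℕ → Vec ℕ n → Set
SupportedBelow i x = ∀ l → i ≤ l → toList x ! l ≡ 0

Bounded : ∀ {n} → List ℕ → Vec ℕ n → Set
Bounded rs x = ∀ l → l < length rs → toList x ! l < rs ! l

module _ {n : ℕ} {x : Vec ℕ n} {i : ℕ} where

  supportedBelow-[]≔ : ∀ q → SupportedBelow i x → SupportedBelow (suc i) (x [ i ]≔ q)
  supportedBelow-[]≔ q supp l i<l =
    ≡.trans (at-[]≔-≢ 0 x q (ℕ.>⇒≢ i<l)) (supp l (ℕ.<⇒≤ i<l))

  supportedBelow-clear : i < n → SupportedBelow (suc i) x → SupportedBelow i (x [ i ]≔ 0)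
  supportedBelow-clear i<n supp l i≤l with l ℕ.≟ i
  ... | yes refl = at-[]≔-≡ 0 x 0 i<n
  ... | no l≢i   = ≡.trans (at-[]≔-≢ 0 x 0 l≢i) (supp l (ℕ.≤∧≢⇒< i≤l (l≢i ∘ ≡.sym)))

  module _ {rs : List ℕ} (length-rs : length rs ≡ i) (i<n : i < n) where

    private
      at-[]≔-below : ∀ q {l} → l < length rs → toList (x [ i ]≔ q) ! l ≡ toList x ! l
      at-[]≔-below q l< = at-[]≔-≢ 0 x q (ℕ.<⇒≢ (≡.subst (_ <_) length-rs l<))

      at-[]≔-length : ∀ q → toList (x [ i ]≔ q) ! length rs ≡ q
      at-[]≔-length q = ≡.trans (≡.cong (toList (x [ i ]≔ q) !_) length-rs) (at-[]≔-≡ 0 x q i<n)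

    bounded-[]≔ : ∀ {q r} → Bounded rs x → q < r → Bounded (rs ++ [ r ]) (x [ i ]≔ q)
    bounded-[]≔ {q} {r} bounded q<r = at-∷ʳ⁺ 0 (λ l r → toList (x [ i ]≔ q) ! l < r) rs r
      (λ l l< → ≡.subst (_< rs ! l) (≡.sym (at-[]≔-below q l<)) (bounded l l<))
      (≡.subst (_< r) (≡.sym (at-[]≔-length q)) q<r)

    horner-[]≔ : ∀ q r → horner (rs ++ [ r ]) (toList (x [ i ]≔ q) !_)
                           ≡ horner rs (toList x !_) + product rs * q
    horner-[]≔ q r = ≡.trans (horner-∷ʳ rs r _) (≡.cong₂ (λ h e → h + product rs * e)
      (horner-cong rs (λ l → at-[]≔-below q)) (at-[]≔-length q))

module _ {c ℓ : Level} (G : AbelianGroup c ℓ) where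
  open AbelianGroup G renaming (Carrier to A; refl to ≈-refl)
  open Grp G
  open import Relation.Binary.Reasoning.Setoid setoid
  open import Algebra.Properties.Monoid.Mult monoid using (×-homo-+; ×-assocˡ; ×-congʳ)
    renaming (_×_ to _·_)
  open import Algebra.Properties.CommutativeSemigroup commutativeSemigroup
    using (interchange; x∙yz≈y∙xz)
  open import Algebra.Properties.AbelianGroup G using (∙-cancelˡ)

  _‼_ : List A → ℕ → A
  _‼_ = at ε

  pow≡· : ∀ g k → pow g k ≡ k · g
  pow≡· g zero    = refl
  pow≡· g (suc k) = ≡.cong (g ∙_) (pow≡· g k)

  pow-homo-+ : ∀ g a b → pow g (a + b) ≈ pow g a ∙ pow g b
  pow-homo-+ g a b rewrite pow≡· g (a + b) | pow≡· g a | pow≡· g b = ×-homo-+ g a b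

  pow-assoc : ∀ g a b → pow (pow g a) b ≈ pow g (b * a)
  pow-assoc g a b rewrite pow≡· (pow g a) b | pow≡· g a | pow≡· g (b * a) = ×-assocˡ g b a

  pow-congˡ : ∀ {g h} k → g ≈ h → pow g k ≈ pow h k
  pow-congˡ {g} {h} k g≈h rewrite pow≡· g k | pow≡· h k = ×-congʳ k g≈h

  pow-ε : ∀ k → pow ε k ≈ ε
  pow-ε zero    = ≈-refl
  pow-ε (suc k) = trans (identityˡ _) (pow-ε k)

  vecPow-vanishing : ∀ {n} (γ : Vec A n) x → (∀ l → toList x ! l ≡ 0) → vecPow γ x ≈ ε
  vecPow-vanishing []      []       _   = ≈-refl
  vecPow-vanishing (g ∷ γ) (x ∷ xs) x≗0 rewrite x≗0 0 =
    trans (identityˡ _) (vecPow-vanishing γ xs (x≗0 ∘ suc))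

  vecPow-homo-+ : ∀ {n} (γ : Vec A n) x y → vecPow γ (zipWith _+_ x y) ≈ vecPow γ x ∙ vecPow γ y
  vecPow-homo-+ []      []       []       = sym (identityˡ ε)
  vecPow-homo-+ (g ∷ γ) (x ∷ xs) (y ∷ ys) = begin
    pow g (x + y) ∙ vecPow γ (zipWith _+_ xs ys)
      ≈⟨ ∙-cong (pow-homo-+ g x y) (vecPow-homo-+ γ xs ys) ⟩
    (pow g x ∙ pow g y) ∙ (vecPow γ xs ∙ vecPow γ ys)
      ≈⟨ interchange _ _ _ _ ⟩
    (pow g x ∙ vecPow γ xs) ∙ (pow g y ∙ vecPow γ ys)
      ∎

  vecPow-[]≔ : ∀ {n} (γ : Vec A n) x i q → toList x ! i ≡ 0 →
               vecPow γ (x [ i ]≔ q) ≈ pow (toList γ ‼ i) q ∙ vecPow γ x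
  vecPow-[]≔ []      []       i       q _    = sym (trans (∙-congʳ (pow-ε q)) (identityˡ ε))
  vecPow-[]≔ (g ∷ γ) (x ∷ xs) zero    q refl = ∙-congˡ (sym (identityˡ _))
  vecPow-[]≔ (g ∷ γ) (x ∷ xs) (suc i) q xᵢ≡0 = begin
    pow g x ∙ vecPow γ (xs [ i ]≔ q)               ≈⟨ ∙-congˡ (vecPow-[]≔ γ xs i q xᵢ≡0) ⟩
    pow g x ∙ (pow (toList γ ‼ i) q ∙ vecPow γ xs) ≈⟨ x∙yz≈y∙xz _ _ _ ⟩
    pow (toList γ ‼ i) q ∙ (pow g x ∙ vecPow γ xs) ∎

  vecPow-split : ∀ {n} (γ : Vec A n) x i →
                 vecPow γ x ≈ pow (toList γ ‼ i) (toList x ! i) ∙ vecPow γ (x [ i ]≔ 0)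
  vecPow-split []      []       i       = sym (identityˡ ε)
  vecPow-split (g ∷ γ) (x ∷ xs) zero    = ∙-congˡ (sym (identityˡ _))
  vecPow-split (g ∷ γ) (x ∷ xs) (suc i) = begin
    pow g x ∙ vecPow γ xs
      ≈⟨ ∙-congˡ (vecPow-split γ xs i) ⟩
    pow g x ∙ (pow (toList γ ‼ i) (toList xs ! i) ∙ vecPow γ (xs [ i ]≔ 0))
      ≈⟨ x∙yz≈y∙xz _ _ _ ⟩
    pow (toList γ ‼ i) (toList xs ! i) ∙ (pow g x ∙ vecPow γ (xs [ i ]≔ 0))
      ∎

  Distinct : List A → Set ℓ
  Distinct T = ∀ a b → a < length T → b < length T → T ‼ a ≈ T ‼ b → a ≡ b

  module Finite {m : ℕ} (order : Order m) where
    private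
      enum : Fin m → A
      enum = proj₁ order

      enum-injective : ∀ a b → enum a ≈ enum b → a ≡ b
      enum-injective = proj₁ (proj₂ (proj₂ order))

      position : A → Fin m
      position g = proj₁ (proj₂ (proj₂ (proj₂ order)) g _)

      enum-position : ∀ g → enum (position g) ≈ g
      enum-position g = proj₂ (proj₂ (proj₂ (proj₂ order)) g _)

      position-injective : ∀ {g h} → position g ≡ position h → g ≈ h
      position-injective {g} {h} eq =
        trans (sym (enum-position g)) (trans (reflexive (≡.cong enum eq)) (enum-position h))

    distinct-length≤ : ∀ T → Distinct T → length T ≤ m
    distinct-length≤ T distinct = Finₚ.injective⇒≤ {f = position ∘ (T ‼_) ∘ toℕ} λ {a} {b} eq →
      Finₚ.toℕ-injective (distinct _ _ (Finₚ.toℕ<n a) (Finₚ.toℕ<n b) (position-injective eq))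

    covering-length≥ : ∀ T → (∀ g → ∃ λ k → k < length T × T ‼ k ≈ g) → m ≤ length T
    covering-length≥ T cover = Finₚ.injective⇒≤ {f = slot} λ {a} {b} eq →
      enum-injective a b (trans (sym (slot-correct a))
        (trans (reflexive (≡.cong ((T ‼_) ∘ toℕ) eq)) (slot-correct b)))
      where
        slot : Fin m → Fin (length T)
        slot a = fromℕ< (proj₁ (proj₂ (cover (enum a))))

        slot-correct : ∀ a → T ‼ toℕ (slot a) ≈ enum a
        slot-correct a rewrite Finₚ.toℕ-fromℕ< (proj₁ (proj₂ (cover (enum a)))) =
          proj₂ (proj₂ (cover (enum a)))

    pow-period : ∀ g → ∃ λ o → pow g (suc o) ≈ ε
    pow-period g with Finₚ.pigeonhole (ℕ.n<1+n m) (position ∘ pow g ∘ toℕ)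
    ... | a , b , a<b , eq = toℕ b ∸ suc (toℕ a) , ∙-cancelˡ (pow g (toℕ a)) _ _ (begin
      pow g (toℕ a) ∙ pow g (suc (toℕ b ∸ suc (toℕ a)))
        ≈⟨ pow-homo-+ g (toℕ a) _ ⟨
      pow g (toℕ a + suc (toℕ b ∸ suc (toℕ a)))
        ≡⟨ ≡.cong (pow g) (≡.trans (ℕ.+-suc (toℕ a) _) (ℕ.m+[n∸m]≡n a<b)) ⟩
      pow g (toℕ b)
        ≈⟨ position-injective eq ⟨
      pow g (toℕ a)
        ≈⟨ identityʳ _ ⟨
      pow g (toℕ a) ∙ ε
        ∎)

  module Primitives (_≟_ : Decidable _≈_) where
    open Algorithm _≟_

    tableLookup-just : ∀ T β {s} → tableLookup T β ≡ just s → s < length T × T ‼ s ≈ β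
    tableLookup-just (t ∷ T) β eq with t ≟ β
    ... | yes t≈β with refl ← eq = s≤s z≤n , t≈β
    ... | no _ with tableLookup T β in found
    ...   | just s with refl ← eq = Data.Product.map s≤s id (tableLookup-just T β found)

    tableLookup-nothing : ∀ T β → tableLookup T β ≡ nothing → ∀ {k} → k < length T → ¬ T ‼ k ≈ β
    tableLookup-nothing (t ∷ T) β eq {k} k< with t ≟ β
    ... | no t≉β with tableLookup T β in missing | k | k<
    ...   | nothing | zero  | _       = t≉β
    ...   | nothing | suc k | s≤s k<′ = tableLookup-nothing T β missing k<′

    insertAll-table : ∀ β xs st → table (insertAll β xs st) ≡ table st ++ map (β ∙_) xs
    insertAll-table β []       st = ≡.sym (List.++-identityʳ _)
    insertAll-table β (x ∷ xs) st =
      ≡.trans (insertAll-table β xs (insertProd β x st)) (List.++-assoc (table st) [ β ∙ x ] _)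

    insertAll-inserts : ∀ β xs st → inserts (insertAll β xs st) ≡ inserts st + length xs
    insertAll-inserts β []       st = ≡.sym (ℕ.+-identityʳ _)
    insertAll-inserts β (x ∷ xs) st =
      ≡.trans (insertAll-inserts β xs (insertProd β x st)) (≡.sym (ℕ.+-suc _ _))

    insertAll-lookups : ∀ β xs st → lookups (insertAll β xs st) ≡ lookups st
    insertAll-lookups β []       st = refl
    insertAll-lookups β (x ∷ xs) st = insertAll-lookups β xs (insertProd β x st)

    insertAll-ops : ∀ β xs st → ops (insertAll β xs st) ≡ ops st + sum (map (cost β) xs)
    insertAll-ops β []       st = ≡.sym (ℕ.+-identityʳ _)
    insertAll-ops β (x ∷ xs) st =
      ≡.trans (insertAll-ops β xs (insertProd β x st)) (ℕ.+-assoc (ops st) _ _)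

    cost-ε : ∀ β {x} → x ≈ ε → cost β x ≡ 0
    cost-ε β {x} x≈ε with β ≟ ε | x ≟ ε
    ... | yes _ | _      = refl
    ... | no _  | yes _  = refl
    ... | no _  | no x≉ε = ⊥-elim (x≉ε x≈ε)

    cost-≉ε : ∀ {β x} → ¬ β ≈ ε → ¬ x ≈ ε → cost β x ≡ 1
    cost-≉ε {β} {x} β≉ε x≉ε with β ≟ ε | x ≟ ε
    ... | yes β≈ε | _       = ⊥-elim (β≉ε β≈ε)
    ... | no _    | yes x≈ε = ⊥-elim (x≉ε x≈ε)
    ... | no _    | no _    = refl

    sum-cost-≉ε : ∀ {β} → ¬ β ≈ ε → ∀ V → (∀ k → k < length V → ¬ V ‼ k ≈ ε) →
                  sum (map (cost β) V) ≡ length V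
    sum-cost-≉ε β≉ε []      _   = refl
    sum-cost-≉ε β≉ε (v ∷ V) V≉ε rewrite cost-≉ε β≉ε (V≉ε 0 (s≤s z≤n)) =
      ≡.cong suc (sum-cost-≉ε β≉ε V (λ k k< → V≉ε (suc k) (s≤s k<)))

    lookedUp : State → State
    lookedUp st = record st { lookups = suc (lookups st) }

    afterMiss : (γi β : A) → List A → State → State
    afterMiss γi β old st = record st′ { ops = ops st′ + cost β γi }
      where st′ = insertAll β old (lookedUp st)

    loop-hit : ∀ f γi β r old st {s} → tableLookup (table st) β ≡ just s →
               loop (suc f) γi β r old st ≡ just (r , s , lookedUp st)
    loop-hit f γi β r old st hit rewrite hit = refl

    loop-miss : ∀ f γi β r old st → tableLookup (table st) β ≡ nothing →
                loop (suc f) γi β r old st ≡ loop f γi (β ∙ γi) (suc r) old (afterMiss γi β old st)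
    loop-miss f γi β r old st miss rewrite miss = refl

    outer-∷ : ∀ f g {k} (gs : Vec A k) st {r s st′ rs ss st″} →
              loop f g g 1 (table st) st ≡ just (r , s , st′) →
              outer f gs st′ ≡ just (rs , ss , st″) →
              outer f (g ∷ gs) st ≡ just (r ∷ rs , s ∷ ss , st″)
    outer-∷ f g gs st first rest rewrite first | rest = refl

  module Correctness (_≟_ : Decidable _≈_) {m : ℕ} (order : Order m) {n : ℕ} (γ : Vec A n) where
    open Algorithm _≟_
    open Primitives _≟_
    open Finite order

    Span : ℕ → A → Set ℓ
    Span i g = Σ (Vec ℕ n) λ x → SupportedBelow i x × g ≈ vecPow γ x

    span-resp : ∀ {i g h} → g ≈ h → Span i g → Span i h
    span-resp g≈h (x , supp , g≈) = x , supp , trans (sym g≈h) g≈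

    span-ε : ∀ i → Span i ε
    span-ε i = replicate n 0 , (λ l _ → at-replicate 0 n l) ,
               sym (vecPow-vanishing γ _ (at-replicate 0 n))

    span-∙ : ∀ {i a b} → Span i a → Span i b → Span i (a ∙ b)
    span-∙ (x , x-supp , a≈) (y , y-supp , b≈) =
      zipWith _+_ x y ,
      (λ l i≤l → ≡.trans (at-zipWith _+_ x y l) (≡.cong₂ _+_ (x-supp l i≤l) (y-supp l i≤l))) ,
      trans (∙-cong a≈ b≈) (sym (vecPow-homo-+ γ x y))

    span-pow : ∀ {i a} k → Span i a → Span i (pow a k)
    span-pow zero    _  = span-ε _
    span-pow (suc k) sa = span-∙ sa (span-pow k sa)

    -- A submonoid of a finite group is a subgroup: t′⁻¹ is a power of t′.
    span-quotient : ∀ {i t t′} h → Span i t → Span i t′ → t ≈ h ∙ t′ → Span i h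
    span-quotient {t = t} {t′} h st st′ t≈ with pow-period t′
    ... | o , t′ᵒ⁺¹≈ε = span-resp t∙t′ᵒ≈h (span-∙ st (span-pow o st′))
      where
        t∙t′ᵒ≈h : t ∙ pow t′ o ≈ h
        t∙t′ᵒ≈h = begin
          t ∙ pow t′ o          ≈⟨ ∙-congʳ t≈ ⟩
          (h ∙ t′) ∙ pow t′ o   ≈⟨ assoc _ _ _ ⟩
          h ∙ pow t′ (suc o)    ≈⟨ ∙-congˡ t′ᵒ⁺¹≈ε ⟩
          h ∙ ε                 ≈⟨ identityʳ h ⟩
          h                     ∎

    inSub⇒span : ∀ {i g} → InSub γ i g → Span i g
    inSub⇒span {i} (x , zeros , g≈) = x , supp , g≈
      where
        supp : SupportedBelow i x
        supp l i≤l with l ℕ.<? n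
        ... | no l≮n  = at-toList-≥ 0 x (ℕ.≮⇒≥ l≮n)
        ... | yes l<n = ≡.subst (λ l → toList x ! l ≡ 0) (Finₚ.toℕ-fromℕ< l<n)
          (≡.trans (≡.sym (lookup≡at-toList 0 x j))
                   (zeros j (≡.subst (i ≤_) (≡.sym (Finₚ.toℕ-fromℕ< l<n)) i≤l)))
          where j = fromℕ< l<n

    span⇒inSub : ∀ {i g} → Span i g → InSub γ i g
    span⇒inSub (x , supp , g≈) =
      x , (λ j i≤j → ≡.trans (lookup≡at-toList 0 x j) (supp (toℕ j) i≤j)) , g≈

    -- The state after the first i generators (0-based γ₀ … γᵢ₋₁, the paper's γ₁ … γᵢ).
    record Invariant (i : ℕ) (rs : List ℕ) (T : List A) : Set (c ⊔ ℓ) where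
      field
        length-radices   : length rs ≡ i
        radices-positive : ∀ l → l < length rs → 0 < rs ! l
        length-table     : length T ≡ product rs
        head-ε           : T ‼ 0 ≈ ε
        distinct         : Distinct T
        layout           : ∀ k → k < length T → ∃ λ x → SupportedBelow i x × Bounded rs x
                             × T ‼ k ≈ vecPow γ x × k ≡ horner rs (toList x !_)
        complete         : ∀ g → Span i g → ∃ λ k → k < length T × T ‼ k ≈ g

      sound : ∀ k → k < length T → Span i (T ‼ k)
      sound k k< with layout k k<
      ... | x , supp , _ , Tₖ≈ , _ = x , supp , Tₖ≈

      nonempty : 0 < length T
      nonempty = ℕ.≤-<-trans z≤n (proj₁ (proj₂ (complete ε (span-ε i))))

      size : HasSize (InSub γ i) (length T)
      size = (λ a → T ‼ toℕ a) ,
             (λ a → span⇒inSub (sound (toℕ a) (Finₚ.toℕ<n a))) ,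
             (λ a b Tₐ≈T_b → Finₚ.toℕ-injective
                               (distinct _ _ (Finₚ.toℕ<n a) (Finₚ.toℕ<n b) Tₐ≈T_b)) ,
             λ g g∈ → let (k , k< , Tₖ≈g) = complete g (inSub⇒span g∈) in
               fromℕ< k< , trans (reflexive (≡.cong (T ‼_) (Finₚ.toℕ-fromℕ< k<))) Tₖ≈g

    -- By distinctness T ‼ 0 ≈ ε is the only trivial entry.
    nontrivial-products : ∀ {i rs T} → Invariant i rs T → ∀ {β} → ¬ β ≈ ε →
                          suc (sum (map (cost β) T)) ≡ length T
    nontrivial-products {T = []}     inv _ with () ← Invariant.nonempty inv
    nontrivial-products {T = t ∷ T′} inv {β} β≉ε rewrite cost-ε β (Invariant.head-ε inv) =
      ≡.cong suc (sum-cost-≉ε β≉ε T′ λ k k< T′ₖ≈ε →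
        ℕ.1+n≢0 (distinct (suc k) 0 (s≤s k<) (s≤s z≤n) (trans T′ₖ≈ε (sym head-ε))))
      where open Invariant inv

    module Round {i : ℕ} {rs : List ℕ} {T : List A}
                 (inv : Invariant i rs T) (γi : A) (L₀ : ℕ) where
      open Invariant inv

      N : ℕ
      N = length T

      instance
        N-nonZero : NonZero N
        N-nonZero = >-nonZero nonempty

      record Blocks (r : ℕ) (U : List A) : Set ℓ where
        constructor mkBlocks
        field
          length-blocks : length U ≡ r * N
          entry         : ∀ q j → q < r → j < N → U ‼ (j + q * N) ≈ pow γi q ∙ T ‼ j
      open Blocks public

      Escapes : ℕ → Set ℓ
      Escapes r = ∀ d → 0 < d → d < r → ¬ Span i (pow γi d)

      coset-separation : ∀ {r} → Escapes r → ∀ {q q′ t t′} → q < q′ → q′ ∸ q < r →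
                         Span i t → Span i t′ → pow γi q ∙ t ≈ pow γi q′ ∙ t′ → ⊥
      coset-separation escapes {q} {q′} {t} {t′} q<q′ d<r st st′ eq =
        escapes d (ℕ.m<n⇒0<n∸m q<q′) d<r (span-quotient _ st st′ t≈γᵈt′)
        where
          d = q′ ∸ q
          q+d≡q′ = ℕ.m+[n∸m]≡n (ℕ.<⇒≤ q<q′)
          t≈γᵈt′ : t ≈ pow γi d ∙ t′
          t≈γᵈt′ = ∙-cancelˡ (pow γi q) _ _ (begin
            pow γi q ∙ t               ≈⟨ eq ⟩
            pow γi q′ ∙ t′             ≡⟨ ≡.cong (λ e → pow γi e ∙ t′) q+d≡q′ ⟨
            pow γi (q + d) ∙ t′        ≈⟨ ∙-congʳ (pow-homo-+ γi q d) ⟩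
            (pow γi q ∙ pow γi d) ∙ t′ ≈⟨ assoc _ _ _ ⟩
            pow γi q ∙ (pow γi d ∙ t′) ∎)

      blocks-distinct : ∀ {r U} → Blocks r U → Escapes r → Distinct U
      blocks-distinct {r} (mkBlocks len entry) escapes a b a< b< Uₐ≈U_b
        with divMod-view {r} {N} (≡.subst (a <_) len a<) | divMod-view {r} {N} (≡.subst (b <_) len b<)
      ... | q , j , q<r , j<N , refl | q′ , j′ , q′<r , j′<N , refl = compare (ℕ.<-cmp q q′)
        where
          cosets : pow γi q ∙ T ‼ j ≈ pow γi q′ ∙ T ‼ j′
          cosets = trans (sym (entry q j q<r j<N)) (trans Uₐ≈U_b (entry q′ j′ q′<r j′<N))

          compare : Tri (q < q′) (q ≡ q′) (q′ < q) → j + q * N ≡ j′ + q′ * N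
          compare (tri< q<q′ _ _) = ⊥-elim (coset-separation escapes q<q′
            (ℕ.≤-<-trans (ℕ.m∸n≤m q′ q) q′<r) (sound j j<N) (sound j′ j′<N) cosets)
          compare (tri> _ _ q′<q) = ⊥-elim (coset-separation escapes q′<q
            (ℕ.≤-<-trans (ℕ.m∸n≤m q q′) q<r) (sound j′ j′<N) (sound j j<N) (sym cosets))
          compare (tri≈ _ refl _) = ≡.cong (_+ q * N)
            (distinct j j′ j<N j′<N (∙-cancelˡ (pow γi q) _ _ cosets))

      blocks-prefix : ∀ {r U} → Blocks r U → 0 < r → ∀ j → j < N → U ‼ j ≈ T ‼ j
      blocks-prefix {U = U} (mkBlocks _ entry) 0<r j j<N = begin
        U ‼ j            ≡⟨ ≡.cong (U ‼_) (ℕ.+-identityʳ j) ⟨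
        U ‼ (j + 0 * N)  ≈⟨ entry 0 j 0<r j<N ⟩
        ε ∙ T ‼ j        ≈⟨ identityˡ _ ⟩
        T ‼ j            ∎

      blocks-extend : ∀ {r U β} → Blocks r U → β ≈ pow γi r → Blocks (suc r) (U ++ map (β ∙_) T)
      blocks-extend {r} {U} {β} (mkBlocks len entry) β≈ = mkBlocks len′ entry′
        where
          U′ = U ++ map (β ∙_) T

          len′ : length U′ ≡ suc r * N
          len′ = ≡.trans (List.length-++ U)
                   (≡.trans (≡.cong₂ _+_ len (List.length-map (β ∙_) T)) (ℕ.+-comm (r * N) N))

          entry′ : ∀ q j → q < suc r → j < N → U′ ‼ (j + q * N) ≈ pow γi q ∙ T ‼ j
          entry′ q j q≤r j<N with ℕ.m≤n⇒m<n∨m≡n (s≤s⁻¹ q≤r)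
          ... | inj₁ q<r = trans
            (reflexive (at-++ˡ ε U _ (≡.subst (_ <_) (≡.sym len) (mixed-radix-< j<N q<r))))
            (entry q j q<r j<N)
          ... | inj₂ refl = begin
            U′ ‼ (j + r * N)
              ≡⟨ ≡.cong (U′ ‼_) (≡.trans (ℕ.+-comm j (r * N)) (≡.cong (_+ j) (≡.sym len))) ⟩
            U′ ‼ (length U + j)   ≡⟨ at-++ʳ ε U _ j ⟩
            map (β ∙_) T ‼ j      ≡⟨ at-map {d = ε} (β ∙_) T j<N ⟩
            β ∙ T ‼ j             ≈⟨ ∙-congʳ β≈ ⟩
            pow γi r ∙ T ‼ j      ∎

      -- The state of the loop (4)–(6) just before its r-th lookup.
      record LoopInvariant (r : ℕ) (β : A) (st : State) : Set (c ⊔ ℓ) where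
        field
          positive      : 0 < r
          β≈            : β ≈ pow γi r
          blocks        : Blocks r (table st)
          escapes       : Escapes r
          ops-count     : suc (ops st) ≡ r * N
          inserts-count : inserts st ≡ r * N
          lookups-count : suc (lookups st) ≡ L₀ + r

        length-table-≥ : N ≤ length (table st)
        length-table-≥ =
          ≡.subst (N ≤_) (≡.sym (length-blocks blocks)) (ℕ.m≤n*m N r {{>-nonZero positive}})

        bounded-by-order : r ≤ m
        bounded-by-order = ℕ.≤-trans (ℕ.m≤m*n r N) (≡.subst (_≤ m) (length-blocks blocks)
          (distinct-length≤ (table st) (blocks-distinct blocks escapes)))

        hit-found : ∀ {s} → tableLookup (table st) β ≡ just s → s < N × T ‼ s ≈ pow γi r
        hit-found hit with tableLookup-just (table st) β hit
        ... | s< , Uₛ≈β with divMod-view {r} {N} (≡.subst (_ <_) (length-blocks blocks) s<)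
        ... | zero  , j , _   , j<N , refl = ≡.subst (_< N) (≡.sym (ℕ.+-identityʳ j)) j<N , (begin
          T ‼ (j + 0)         ≡⟨ ≡.cong (T ‼_) (ℕ.+-identityʳ j) ⟩
          T ‼ j               ≈⟨ identityˡ _ ⟨
          ε ∙ T ‼ j           ≈⟨ entry blocks 0 j positive j<N ⟨
          table st ‼ (j + 0)  ≈⟨ trans Uₛ≈β β≈ ⟩
          pow γi r            ∎)
        ... | suc q , j , q<r , j<N , refl = ⊥-elim (coset-separation escapes q<r
          (ℕ.∸-monoʳ-< (s≤s z≤n) (ℕ.<⇒≤ q<r)) (sound j j<N) (span-ε i)
          (trans (sym (entry blocks (suc q) j q<r j<N)) (trans Uₛ≈β (trans β≈ (sym (identityʳ _))))))

      loopInvariant-start : ∀ {st} → table st ≡ T → suc (ops st) ≡ N → inserts st ≡ N →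
                            lookups st ≡ L₀ → LoopInvariant 1 γi st
      loopInvariant-start refl ops≡ inserts≡ refl = record
        { positive      = s≤s z≤n
        ; β≈            = sym (identityʳ γi)
        ; blocks        = mkBlocks (≡.sym (ℕ.*-identityˡ N)) λ
            { zero    j _        _ →
                trans (reflexive (≡.cong (T ‼_) (ℕ.+-identityʳ j))) (sym (identityˡ _))
            ; (suc _) _ (s≤s ()) _ }
        ; escapes       = λ d 0<d d<1 → ⊥-elim (ℕ.<⇒≱ d<1 0<d)
        ; ops-count     = ≡.trans ops≡ (≡.sym (ℕ.*-identityˡ N))
        ; inserts-count = ≡.trans inserts≡ (≡.sym (ℕ.*-identityˡ N))
        ; lookups-count = ℕ.+-comm 1 _
        }

      miss-step : ∀ {r β st} → LoopInvariant r β st → tableLookup (table st) β ≡ nothing →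
                  LoopInvariant (suc r) (β ∙ γi) (afterMiss γi β T st)
      miss-step {r} {β} {st} li miss = record
        { positive      = s≤s z≤n
        ; β≈            = trans (∙-congʳ β≈) (comm _ _)
        ; blocks        = ≡.subst (Blocks (suc r)) (≡.sym (insertAll-table β T st₁))
                            (blocks-extend blocks β≈)
        ; escapes       = escapes′
        ; ops-count     = ≡.trans (≡.cong (λ o → suc (o + cost β γi)) (insertAll-ops β T st₁))
                            (≡.trans (≡.cong (λ c → suc (ops st + _ + c)) (cost-≉ε β≉ε γi≉ε))
                              (ops-step {r = r} ops-count (nontrivial-products inv β≉ε)))
        ; inserts-count = ≡.trans (insertAll-inserts β T st₁)
                            (≡.trans (≡.cong (_+ N) inserts-count) (ℕ.+-comm (r * N) N))
        ; lookups-count = ≡.trans (≡.cong suc (insertAll-lookups β T st₁))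
                            (≡.trans (≡.cong suc lookups-count) (≡.sym (ℕ.+-suc L₀ r)))
        }
        where
          open LoopInvariant li
          st₁ = lookedUp st

          β∉span : ¬ Span i β
          β∉span β∈ with complete β β∈
          ... | j , j<N , Tⱼ≈β = tableLookup-nothing (table st) β miss
            (ℕ.<-≤-trans j<N length-table-≥) (trans (blocks-prefix blocks positive j j<N) Tⱼ≈β)

          β≉ε : ¬ β ≈ ε
          β≉ε β≈ε = β∉span (span-resp (sym β≈ε) (span-ε i))

          γi≉ε : ¬ γi ≈ ε
          γi≉ε γi≈ε = β≉ε (trans β≈ (trans (pow-congˡ r γi≈ε) (pow-ε r)))

          escapes′ : Escapes (suc r)
          escapes′ d 0<d d≤r with ℕ.m≤n⇒m<n∨m≡n (s≤s⁻¹ d≤r)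
          ... | inj₁ d<r  = escapes d 0<d d<r
          ... | inj₂ refl = β∉span ∘ span-resp (sym β≈)

      record Halts (f r : ℕ) (β : A) (st : State) : Set (c ⊔ ℓ) where
        field
          {r′ s}    : ℕ
          {β′}      : A
          {st′}     : State
          loop-eq   : loop f γi β r T st ≡ just (r′ , s , lookedUp st′)
          invariant : LoopInvariant r′ β′ st′
          found     : s < N × T ‼ s ≈ pow γi r′

      loop-halts : ∀ f {r β st} → LoopInvariant r β st → m < f + r → Halts f r β st
      loop-halts zero    li m<r = ⊥-elim (ℕ.<⇒≱ m<r (LoopInvariant.bounded-by-order li))
      loop-halts (suc f) {r} {β} {st} li bound with tableLookup (table st) β in result
      ... | just s  = record
        { loop-eq = loop-hit f γi β r T st result ; invariant = li
        ; found = LoopInvariant.hit-found li result }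
      ... | nothing = record
        { loop-eq = ≡.trans (loop-miss f γi β r T st result) loop-eq ; invariant = invariant
        ; found = found }
        where
          open Halts (loop-halts f (miss-step li result) (≡.subst (m <_) (≡.sym (ℕ.+-suc f r)) bound))

      module _ (i<n : i < n) (γᵢ≡ : toList γ ‼ i ≡ γi)
               {R : ℕ} {U : List A} (positive : 0 < R) (bl : Blocks R U) where

        layout-extend : ∀ k → k < length U → ∃ λ x → SupportedBelow (suc i) x × Bounded (rs ++ [ R ]) x
                          × U ‼ k ≈ vecPow γ x × k ≡ horner (rs ++ [ R ]) (toList x !_)
        layout-extend k k< with divMod-view {R} {N} (≡.subst (k <_) (length-blocks bl) k<)
        ... | q , j , q<R , j<N , refl with layout j j<N
        ... | x , supp , bounded , Tⱼ≈ , j≡ =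
          x [ i ]≔ q ,
          supportedBelow-[]≔ {x = x} q supp ,
          bounded-[]≔ {x = x} {rs = rs} length-radices i<n bounded q<R ,
          value ,
          ≡.trans (≡.cong₂ _+_ j≡ (≡.trans (ℕ.*-comm q N) (≡.cong (_* q) length-table)))
                  (≡.sym (horner-[]≔ {x = x} {rs = rs} length-radices i<n q R))
          where
            value : U ‼ (j + q * N) ≈ vecPow γ (x [ i ]≔ q)
            value = begin
              U ‼ (j + q * N)                    ≈⟨ entry bl q j q<R j<N ⟩
              pow γi q ∙ T ‼ j                   ≡⟨ ≡.cong (λ g → pow g q ∙ T ‼ j) γᵢ≡ ⟨
              pow (toList γ ‼ i) q ∙ T ‼ j       ≈⟨ ∙-congˡ Tⱼ≈ ⟩
              pow (toList γ ‼ i) q ∙ vecPow γ x  ≈⟨ vecPow-[]≔ γ x i q (supp i ℕ.≤-refl) ⟨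
              vecPow γ (x [ i ]≔ q)              ∎

        -- With v = t + (v / R) · R, g = γᵢ^t · rest where rest ∈ Gᵢ since γᵢ^R ∈ Gᵢ; so g is
        -- in block t of the new table.
        complete-extend : Span i (pow γi R) →
                          ∀ g → Span (suc i) g → ∃ λ k → k < length U × U ‼ k ≈ g
        complete-extend γᴿ∈ g (x , supp , g≈) = j + t * N , k< , sym g≈Uₖ
          where
            instance
              R-nonZero : NonZero R
              R-nonZero = >-nonZero positive
            v  = toList x ! i
            t  = v % R
            x′ = x [ i ]≔ 0

            rest = pow (pow γi R) (v / R) ∙ vecPow γ x′
            rest∈ : Span i rest
            rest∈ = span-∙ (span-pow (v / R) γᴿ∈) (x′ , supportedBelow-clear {x = x} i<n supp , ≈-refl)

            j   = proj₁ (complete rest rest∈)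
            j<N = proj₁ (proj₂ (complete rest rest∈))
            Tⱼ≈ = proj₂ (proj₂ (complete rest rest∈))

            k< : j + t * N < length U
            k< = ≡.subst (j + t * N <_) (≡.sym (length-blocks bl)) (mixed-radix-< j<N (m%n<n v R))

            g≈Uₖ : g ≈ U ‼ (j + t * N)
            g≈Uₖ = begin
              g                                              ≈⟨ g≈ ⟩
              vecPow γ x                                     ≈⟨ vecPow-split γ x i ⟩
              pow (toList γ ‼ i) v ∙ vecPow γ x′
                ≡⟨ ≡.cong₂ (λ h e → pow h e ∙ vecPow γ x′) γᵢ≡ (m≡m%n+[m/n]*n v R) ⟩
              pow γi (t + v / R * R) ∙ vecPow γ x′           ≈⟨ ∙-congʳ (pow-homo-+ γi t _) ⟩
              (pow γi t ∙ pow γi (v / R * R)) ∙ vecPow γ x′  ≈⟨ assoc _ _ _ ⟩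
              pow γi t ∙ (pow γi (v / R * R) ∙ vecPow γ x′)
                ≈⟨ ∙-congˡ (∙-congʳ (pow-assoc γi R (v / R))) ⟨
              pow γi t ∙ rest                                ≈⟨ ∙-congˡ Tⱼ≈ ⟨
              pow γi t ∙ T ‼ j                               ≈⟨ entry bl t j (m%n<n v R) j<N ⟨
              U ‼ (j + t * N)                                ∎

        invariant-extend : Escapes R → Span i (pow γi R) → Invariant (suc i) (rs ++ [ R ]) U
        invariant-extend escapes γᴿ∈ = record
          { length-radices   = ≡.trans (List.length-++ rs)
                                 (≡.trans (≡.cong (_+ 1) length-radices) (ℕ.+-comm i 1))
          ; radices-positive = at-∷ʳ⁺ 0 (λ _ r → 0 < r) rs R radices-positive positive
          ; length-table     = ≡.trans (length-blocks bl) (≡.trans (ℕ.*-comm R N) (≡.sym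
                                 (≡.trans (product-++ rs [ R ])
                                          (≡.cong₂ _*_ (≡.sym length-table) (ℕ.*-identityʳ R)))))
          ; head-ε           = trans (blocks-prefix bl positive 0 nonempty) head-ε
          ; distinct         = blocks-distinct bl escapes
          ; layout           = layout-extend
          ; complete         = complete-extend γᴿ∈
          }

    record Counted (rs : List ℕ) (st : State) : Set c where
      field
        ops-counted     : suc (ops st) ≡ length (table st)
        inserts-counted : inserts st ≡ length (table st)
        lookups-counted : lookups st ≡ sum rs

    HasIndex : ℕ → ℕ → Set (c ⊔ ℓ)
    HasIndex i r = ∃ λ a → ∃ λ b → HasSize (InSub γ i) a × HasSize (InSub γ (suc i)) b × b ≡ r * a

    PowerRelation : List ℕ → ℕ → ℕ → ℕ → Set ℓ
    PowerRelation rs i r s =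
      ∃ λ x → Bounded rs x × pow (toList γ ‼ i) r ≈ vecPow γ x × s ≡ horner rs (toList x !_)

    powerRelation : ∀ {i rs T s r} → Invariant i rs T → s < length T → T ‼ s ≈ pow (toList γ ‼ i) r →
                    ∀ more → (∀ l → l < length (rs ++ more) → 0 < (rs ++ more) ! l) →
                    PowerRelation (rs ++ more) i r s
    powerRelation {i} {rs} inv s< Tₛ≈ more positive with Invariant.layout inv _ s<
    ... | x , supp , bounded , Tₛ≈x , s≡ =
      x , bounded′ , trans (sym Tₛ≈) Tₛ≈x ,
      ≡.trans s≡ (≡.sym (horner-++ rs more (λ l rs≤l → supp l (≡.subst (_≤ l) length-radices rs≤l))))
      where
        open Invariant inv
        bounded′ : Bounded (rs ++ more) x
        bounded′ l l< with l ℕ.<? length rs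
        ... | yes l<rs = ≡.subst (_ <_) (≡.sym (at-++ˡ 0 rs more l<rs)) (bounded l l<rs)
        ... | no l≮rs  = ≡.subst (_< _)
          (≡.sym (supp l (≡.subst (_≤ l) length-radices (ℕ.≮⇒≥ l≮rs)))) (positive l l<)

    record StageResult (i : ℕ) (rs : List ℕ) (st : State) : Set (c ⊔ ℓ) where
      field
        {R s}          : ℕ
        {st′}          : State
        run-loop       : loop (suc m) (toList γ ‼ i) (toList γ ‼ i) 1 (table st) st ≡ just (R , s , st′)
        next-invariant : Invariant (suc i) (rs ++ [ R ]) (table st′)
        next-counted   : Counted (rs ++ [ R ]) st′
        index          : HasIndex i R
        found          : s < length (table st) × table st ‼ s ≈ pow (toList γ ‼ i) R

    stage : ∀ {i rs st} → i < n → Invariant i rs (table st) → Counted rs st → StageResult i rs st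
    stage {i} {rs} {st} i<n inv counted = record
      { run-loop       = loop-eq
      ; next-invariant = inv′
      ; next-counted   = record
          { ops-counted     = ≡.trans ops-count (≡.sym (length-blocks blocks))
          ; inserts-counted = ≡.trans inserts-count (≡.sym (length-blocks blocks))
          ; lookups-counted = ≡.trans lookups-count (≡.trans (≡.cong (_+ r′) lookups-counted)
              (≡.sym (≡.trans (sum-++ rs [ r′ ]) (≡.cong (sum rs +_) (ℕ.+-identityʳ r′)))))
          }
      ; index          = _ , _ , Invariant.size inv , Invariant.size inv′ , length-blocks blocks
      ; found          = found
      }
      where
        open Counted counted
        open Round inv (toList γ ‼ i) (lookups st)
        open Halts (loop-halts (suc m) (loopInvariant-start refl ops-counted inserts-counted refl)
                               (ℕ.m≤m+n (suc m) 1))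
        open LoopInvariant invariant
        inv′ = invariant-extend i<n refl positive blocks escapes
                 (span-resp (proj₂ found) (Invariant.sound inv _ (proj₁ found)))

    record Outcome {k} (i : ℕ) (rs : List ℕ) (gs : Vec A k) (st : State) : Set (c ⊔ ℓ) where
      field
        {radices positions} : Vec ℕ k
        {final}             : State
        run-outer           : outer (suc m) gs st ≡ just (radices , positions , final)
        final-invariant     : Invariant n (rs ++ toList radices) (table final)
        final-counted       : Counted (rs ++ toList radices) final
        indices             : ∀ j → j < k → HasIndex (i + j) (toList radices ! j)
        relations           : ∀ j → j < k → PowerRelation (rs ++ toList radices) (i + j)
                                                (toList radices ! j) (toList positions ! j)

    outer-correct : ∀ {k} (gs : Vec A k) {i rs st} → i + k ≡ n →
                    (∀ j → toList gs ‼ j ≡ toList γ ‼ (i + j)) →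
                    Invariant i rs (table st) → Counted rs st → Outcome i rs gs st
    outer-correct [] {i} {rs} i+0≡n _ inv counted = record
      { run-outer       = refl
      ; final-invariant = ≡.subst₂ (λ i rs → Invariant i rs _)
                            (≡.trans (≡.sym (ℕ.+-identityʳ i)) i+0≡n) (≡.sym (List.++-identityʳ rs)) inv
      ; final-counted   = ≡.subst (λ rs → Counted rs _) (≡.sym (List.++-identityʳ rs)) counted
      ; indices         = λ _ ()
      ; relations       = λ _ ()
      }
    outer-correct (g ∷ gs) {i} {rs} {st} i+k≡n suffix inv counted
      with refl ← ≡.trans (suffix 0) (≡.cong (toList γ ‼_) (ℕ.+-identityʳ i)) = record
      { run-outer       = outer-∷ (suc m) g gs st run-loop run-outer
      ; final-invariant = final-invariant′
      ; final-counted   = ≡.subst (λ rs → Counted rs final) radices-assoc final-counted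
      ; indices         = λ
          { zero    _        → ≡.subst (λ i → HasIndex i R) (≡.sym (ℕ.+-identityʳ i)) index
          ; (suc j) (s≤s j<) → ≡.subst (λ i → HasIndex i (toList radices ! j)) (≡.sym (ℕ.+-suc i j))
                                 (indices j j<) }
      ; relations       = λ
          { zero    _        → ≡.subst (λ i → PowerRelation (rs ++ R ∷ toList radices) i R s)
                                 (≡.sym (ℕ.+-identityʳ i))
                                 (powerRelation {r = R} inv (proj₁ found) (proj₂ found) (R ∷ toList radices)
                                   (Invariant.radices-positive final-invariant′))
          ; (suc j) (s≤s j<) → ≡.subst₂
              (λ rs i → PowerRelation rs i (toList radices ! j) (toList positions ! j))
              radices-assoc (≡.sym (ℕ.+-suc i j)) (relations j j<) }
      }
      where
        open StageResult (stage (≡.subst (i <_) i+k≡n (ℕ.m<m+n i (s≤s z≤n))) inv counted)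
        open Outcome (outer-correct gs (≡.trans (≡.sym (ℕ.+-suc i _)) i+k≡n)
                       (λ j → ≡.trans (suffix (suc j)) (≡.cong (toList γ ‼_) (ℕ.+-suc i j)))
                       next-invariant next-counted)

        radices-assoc : (rs ++ [ R ]) ++ toList radices ≡ rs ++ R ∷ toList radices
        radices-assoc = List.++-assoc rs [ R ] (toList radices)

        final-invariant′ : Invariant n (rs ++ R ∷ toList radices) (table final)
        final-invariant′ = ≡.subst (λ rs → Invariant n rs (table final)) radices-assoc final-invariant

    initial-invariant : Invariant 0 [] [ ε ]
    initial-invariant = record
      { length-radices   = refl
      ; radices-positive = λ _ ()
      ; length-table     = refl
      ; head-ε           = ≈-refl
      ; distinct         = λ { zero zero _ _ _ → refl ; (suc _) _ (s≤s ()) _ _ ; zero (suc _) _ (s≤s ()) _ }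
      ; layout           = λ { zero _ → let (x , supp , ε≈) = span-ε 0 in x , supp , (λ _ ()) , ε≈ , refl
                             ; (suc _) (s≤s ()) }
      ; complete         = λ { g (x , supp , g≈) →
                             0 , s≤s z≤n , sym (trans g≈ (vecPow-vanishing γ x (λ l → supp l z≤n))) }
      }

    initial-counted : Counted [] initial
    initial-counted = record { ops-counted = refl ; inserts-counted = refl ; lookups-counted = refl }

    module Result (generates : Generates γ) where
      open Outcome (outer-correct γ refl (λ _ → refl) initial-invariant initial-counted) public

      table-size : length (table final) ≡ m
      table-size = ℕ.≤-antisym (distinct-length≤ (table final) (Invariant.distinct final-invariant))
        (covering-length≥ (table final) λ g →
          Invariant.complete final-invariant g (inSub⇒span (generates g)))

      index-of : ∀ j → IsIndex γ j (lookup radices j)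
      index-of j rewrite lookup≡at-toList 0 radices j = indices (toℕ j) (Finₚ.toℕ<n j)

      relation-of : ∀ j → ∃ λ x → (∀ j′ → lookup x j′ < lookup radices j′)
                      × pow (lookup γ j) (lookup radices j) ≈ vecPow γ x × lookup positions j ≡ Z radices x
      relation-of j with relations (toℕ j) (Finₚ.toℕ<n j)
      ... | x , bounded , γʳ≈ , s≡
        rewrite lookup≡at-toList ε γ j | lookup≡at-toList 0 radices j | lookup≡at-toList 0 positions j =
        x , bounded′ , γʳ≈ , ≡.trans s≡ (≡.sym (mixed-radix-sum≡horner radices x))
        where
          bounded′ : ∀ j′ → lookup x j′ < lookup radices j′
          bounded′ j′ rewrite lookup≡at-toList 0 x j′ | lookup≡at-toList 0 radices j′ =
            bounded (toℕ j′) (≡.subst (toℕ j′ <_) (≡.sym (Data.Vec.Properties.length-toList radices))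
                                      (Finₚ.toℕ<n j′))

proposition6 : ∀ {c ℓ : Level} (G : AbelianGroup c ℓ)
    (_≟_ : Decidable (AbelianGroup._≈_ G))
    (m : ℕ) → Grp.Order G m
    → (n : ℕ) (γ : Vec (AbelianGroup.Carrier G) n) → Grp.Generates G γ
    → ∃ λ fuel → ∃ λ (r : Vec ℕ n) → ∃ λ (s : Vec ℕ n) → ∃ λ st →
        Grp.Algorithm.run G _≟_ fuel γ ≡ just (r , s , st)
      × (∀ (i : Fin n) → Grp.IsIndex G γ i (lookup r i))
      × (∀ (i : Fin n) → ∃ λ (x : Vec ℕ n) →
            (∀ (j : Fin n) → lookup x j < lookup r j)
          × AbelianGroup._≈_ G (Grp.pow G (lookup γ i) (lookup r i)) (Grp.vecPow G γ x)
          × lookup s i ≡ Grp.Z G r x)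
      × Grp.Algorithm.ops st ≡ m ∸ 1
      × Grp.Algorithm.inserts st ≡ m
      × Grp.Algorithm.lookups st ≡ sum (toList r)
proposition6 G _≟_ m order n γ generates =
  suc m , radices , positions , final , run-outer , index-of , relation-of ,
  ≡.cong (_∸ 1) (≡.trans ops-counted table-size) , ≡.trans inserts-counted table-size ,
  lookups-counted
  where
    open Correctness G _≟_ order γ
    open Result generates
    open Counted final-counted
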